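{- Let $R$ be a commutative ring with $1$ and $\mathcal{A}$ a set of non-commuting symbols. On the set of $R$-valued multiple reciprocity functions based on $\mathcal{A}$, the product $\bullet$ is associative, the constant function $1$ is a unit for $\bullet$, and every multiple reciprocity function $F_{\mathcal{A}}$ has a unique inverse with respect to $\bullet$.
   Context: $\mathcal{A}^*$ is the set of words in $\mathcal{A}$ (including $\emptyset$), $R\langle\langle\mathcal{A}\rangle\rangle$ the ring of non-commutative formal power series $\sum_{w\in\mathcal{A}^*}c_ww$, $R\langle\langle\mathcal{A}\rangle\rangle^\times$ its unit group, $U=\{(p,q)\in\mathbb{Z}^2:\gcd(p,q)=1\}$. An $R$-valued multiple Dedekind symbol based on $\mathcal{A}$ is a map $D:U\to R\langle\langle\mathcal{A}\rangle\rangle^\times$ of the form $1+\sum_{w\neq\emptyset}D^w(p,q)w$ with $D(p,-q)=D(-p,q)$ and $D(p,q)=D(p,p+q)$; it is normalized if $D(1,1)=1$; its associated function is $D(p,q)D(-q,p)^{ -1}$. An $R$-valued multiple reciprocity function based on $\mathcal{A}$ is a map $F:U\to R\langle\langle\mathcal{A}\rangle\rangle^\times$ of the form $1+\sum_{w\neq\emptyset}F^w(p,q)w$ with $F(p,-q)=F(-p,q)$, $F(p,q)F(-q,p)=1$, $F(p,p+q)F(p+q,q)=F(p,q)$. Every multiple reciprocity function $F$ is the associated function of a unique normalized multiple Dedekind symbol $D_F$. The product of multiple reciprocity functions $F,G$ is defined by $(F\bullet G)(p,q)=D_F(p,q)D_G(p,q)D_G(-q,p)^{ -1}D_F(-q,p)^{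 -1}=D_F(p,q)G(p,q)D_F(-q,p)^{ -1}$, i.e. the multiple reciprocity function whose associated normalized multiple Dedekind symbol is $D_FD_G$. -}

module Defs where

open import Level using (Level; _⊔_)
open import Algebra.Bundles using (CommutativeRing)
open import Data.List using (List; []; _∷_; map; foldr; length)
open import Data.Product using (Σ; _×_; _,_; proj₁; proj₂)
open import Data.Nat using (ℕ; zero; suc)
open import Data.Nat.Coprimality using (Coprime)
open import Data.Integer using (ℤ; ∣_∣; 1ℤ) renaming (_+_ to _+ℤ_; -_ to -ℤ_)

InU : ℤ → ℤ → Set
InU p q = Coprime ∣ p ∣ ∣ q ∣

module Series {c ℓ} (R : CommutativeRing c ℓ) {a} (A : Set a) where
  open CommutativeRing R

  Word : Set a
  Word = List A

  Ser : Set (a ⊔ c)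
  Ser = Word → Carrier

  _≈ₛ_ : Ser → Ser → Set (a ⊔ ℓ)
  f ≈ₛ g = ∀ w → f w ≈ g w

  splits : Word → List (Word × Word)
  splits []       = ([] , []) ∷ []
  splits (x ∷ w)  = ([] , x ∷ w) ∷ map (λ uv → (x ∷ proj₁ uv , proj₂ uv)) (splits w)

  sumR : List Carrier → Carrier
  sumR = foldr _+_ 0#

  oneₛ : Ser
  oneₛ []      = 1#
  oneₛ (_ ∷ _) = 0#

  _*ₛ_ : Ser → Ser → Ser
  (f *ₛ g) w = sumR (map (λ uv → f (proj₁ uv) * g (proj₂ uv)) (splits w))

  infixl 7 _*ₛ_

  -- inverse of a series with constant term 1:
  --   g([]) = 1,  g(x w) = - Σ_{x w = u v, u ≠ []} f(u) g(v)
  -- (computed with fuel = length of the word, which always suffices)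
  invAux : ℕ → Ser → Ser
  invAux _       f []      = 1#
  invAux zero    f (_ ∷ _) = 0#
  invAux (suc n) f (x ∷ w) =
    - sumR (map (λ uv → f (x ∷ proj₁ uv) * invAux n f (proj₂ uv)) (splits w))

  invₛ : Ser → Ser
  invₛ f w = invAux (length w) f w

  -- maps U → R⟨⟨A⟩⟩ are represented as functions on ℤ × ℤ;
  -- only their values on U matter
  Fun : Set (a ⊔ c)
  Fun = ℤ → ℤ → Ser

  _≈U_ : Fun → Fun → Set (a ⊔ ℓ)
  F ≈U G = ∀ p q → InU p q → F p q ≈ₛ G p q

  ConstOne : Fun → Set ℓ
  ConstOne F = ∀ p q → InU p q → F p q [] ≈ 1#

  IsMDS : Fun → Set (a ⊔ ℓ)
  IsMDS D = ConstOne D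
          × (∀ p q → InU p q → D p (-ℤ q) ≈ₛ D (-ℤ p) q)
          × (∀ p q → InU p q → D p q ≈ₛ D p (p +ℤ q))

  IsNormMDS : Fun → Set (a ⊔ ℓ)
  IsNormMDS D = IsMDS D × (D 1ℤ 1ℤ ≈ₛ oneₛ)

  assoc : Fun → Fun
  assoc D p q = D p q *ₛ invₛ (D (-ℤ q) p)

  IsMRF : Fun → Set (a ⊔ ℓ)
  IsMRF F = ConstOne F
          × (∀ p q → InU p q → F p (-ℤ q) ≈ₛ F (-ℤ p) q)
          × (∀ p q → InU p q → (F p q *ₛ F (-ℤ q) p) ≈ₛ oneₛ)
          × (∀ p q → InU p q → (F p (p +ℤ q) *ₛ F (p +ℤ q) q) ≈ₛ F p q)

  oneF : Fun
  oneF _ _ = oneₛ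

  -- the known fact: every MRF F is the associated function of a unique
  -- normalized MDS D_F.  `d` is a choice of D_F for each F.
  DFSpec : (Fun → Fun) → Set (a ⊔ c ⊔ ℓ)
  DFSpec d = ∀ F → IsMRF F → IsNormMDS (d F) × (assoc (d F) ≈U F)

  DFUnique : Set (a ⊔ c ⊔ ℓ)
  DFUnique = ∀ F D D′ → IsMRF F → IsNormMDS D → IsNormMDS D′
           → assoc D ≈U F → assoc D′ ≈U F → D ≈U D′

  bullet : (Fun → Fun) → Fun → Fun → Fun
  bullet d F G p q = d F p q *ₛ G p q *ₛ invₛ (d F (-ℤ q) p)

-- F ↦ D_F turns • into the pointwise product of normalized multiple Dedekind symbols:
-- D_F(p,q) G(p,q) D_F(-q,p)⁻¹ is the associated function of the normalized symbol D_F D_G,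
-- so uniqueness of normalized symbols gives D_(F • G) = D_F D_G. Power series with
-- constant term 1 form a group, hence so do normalized symbols under the pointwise
-- product, and the associated function of a symbol is a reciprocity function.
-- Associativity, the unit and the inverse (the associated function of D_F⁻¹) are
-- transported from that group along the injective map F ↦ D_F.
module Submission where

open import Level using (_⊔_)
open import Algebra.Bundles using (CommutativeRing; Monoid)
open import Algebra.Structures using (IsMonoid)
import Algebra.Properties.Monoid as MonoidProperties
import Algebra.Properties.Semigroup as SemigroupProperties
open import Data.Product using (Σ; _×_; _,_; proj₁; proj₂)
open import Data.List using (List; []; _∷_; map; length)
open import Data.List.Properties using (map-∘)
open import Data.List.Relation.Unary.All as All using (All; []; _∷_)
open import Data.List.Relation.Unary.All.Properties using (map⁺)
open import Data.Nat using (suc; z≤n; s≤s) renaming (_≤_ to _≤ℕ_)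
open import Data.Nat.Properties using (≤-refl; ≤-trans; m≤n⇒m≤1+n)
open import Data.Integer using (+_) renaming (_+_ to _+ℤ_; -_ to -ℤ_)
open import Data.Integer.Properties using (∣-i∣≡∣i∣; neg-involutive; +-comm)
open import Data.Integer.Divisibility.Signed using (∣ᵤ⇒∣; ∣⇒∣ᵤ; ∣m+n∣m⇒∣n)
import Data.Integer.Tactic.RingSolver as ℤ-Solver
import Data.Nat.Coprimality as Coprimality
open import Relation.Binary.Bundles using (Setoid)
open import Relation.Binary.PropositionalEquality as ≡ using (_≡_)
import Relation.Binary.Reasoning.Setoid as SetoidReasoning
open import Defs

module SeriesAlgebra {c ℓ} (R : CommutativeRing c ℓ) {a} (A : Set a) where
  open CommutativeRing R
  open Series R A

  ≈ₛ-setoid : Setoid (a ⊔ c) (a ⊔ ℓ)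
  ≈ₛ-setoid = record
    { Carrier = Ser
    ; _≈_ = _≈ₛ_
    ; isEquivalence = record
      { refl = λ _ → refl
      ; sym = λ e w → sym (e w)
      ; trans = λ e e′ w → trans (e w) (e′ w)
      }
    }

  open Setoid ≈ₛ-setoid public using ()
    renaming (refl to ≈ₛ-refl; sym to ≈ₛ-sym; trans to ≈ₛ-trans; reflexive to ≈ₛ-reflexive)

  module _ {b} {B : Set b} where

    sumR-cong : (L : List B) {φ ψ : B → Carrier} →
                (∀ x → φ x ≈ ψ x) → sumR (map φ L) ≈ sumR (map ψ L)
    sumR-cong []      e = refl
    sumR-cong (x ∷ L) e = +-cong (e x) (sumR-cong L e)

    sumR-cong-All : ∀ {p} {P : B → Set p} {L : List B} → All P L → {φ ψ : B → Carrier} →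
                    (∀ x → P x → φ x ≈ ψ x) → sumR (map φ L) ≈ sumR (map ψ L)
    sumR-cong-All []         e = refl
    sumR-cong-All (px ∷ pxs) e = +-cong (e _ px) (sumR-cong-All pxs e)

    sumR-+ : (L : List B) (φ ψ : B → Carrier) →
             sumR (map (λ x → φ x + ψ x) L) ≈ sumR (map φ L) + sumR (map ψ L)
    sumR-+ []      φ ψ = sym (+-identityʳ 0#)
    sumR-+ (x ∷ L) φ ψ = trans (+-cong refl (sumR-+ L φ ψ)) (interchange (φ x) (ψ x) _ _)
      where open import Algebra.Properties.CommutativeSemigroup +-commutativeSemigroup
              using (interchange)

    sumR-*ˡ : (L : List B) (k : Carrier) (φ : B → Carrier) →
              sumR (map (λ x → k * φ x) L) ≈ k * sumR (map φ L)
    sumR-*ˡ []      k φ = sym (zeroʳ k)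
    sumR-*ˡ (x ∷ L) k φ = trans (+-cong refl (sumR-*ˡ L k φ)) (sym (distribˡ k (φ x) _))

  shiftₛ : A → Ser → Ser
  shiftₛ x f u = f (x ∷ u)

  *ₛ-∷ : ∀ f g x w → (f *ₛ g) (x ∷ w) ≡ f [] * g (x ∷ w) + (shiftₛ x f *ₛ g) w
  *ₛ-∷ f g x w = ≡.cong (λ l → f [] * g (x ∷ w) + sumR l) (≡.sym (map-∘ (splits w)))

  *ₛ-cong : ∀ {f f′ g g′} → f ≈ₛ f′ → g ≈ₛ g′ → (f *ₛ g) ≈ₛ (f′ *ₛ g′)
  *ₛ-cong e e′ w = sumR-cong (splits w) (λ _ → *-cong (e _) (e′ _))

  *ₛ-identityˡ : ∀ g → (oneₛ *ₛ g) ≈ₛ g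
  *ₛ-identityˡ g []      = trans (+-identityʳ _) (*-identityˡ _)
  *ₛ-identityˡ g (x ∷ w) = begin
    (oneₛ *ₛ g) (x ∷ w)                         ≡⟨ *ₛ-∷ oneₛ g x w ⟩
    1# * g (x ∷ w) + (shiftₛ x oneₛ *ₛ g) w     ≈⟨ +-cong (*-identityˡ _) (sumR-*ˡ (splits w) 0# _) ⟩
    g (x ∷ w) + 0# * _                          ≈⟨ +-cong refl (zeroˡ _) ⟩
    g (x ∷ w) + 0#                              ≈⟨ +-identityʳ _ ⟩
    g (x ∷ w)                                   ∎
    where open SetoidReasoning setoid

  *ₛ-identityʳ : ∀ f → (f *ₛ oneₛ) ≈ₛ f
  *ₛ-identityʳ f []      = trans (+-identityʳ _) (*-identityʳ _)
  *ₛ-identityʳ f (x ∷ w) = begin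
    (f *ₛ oneₛ) (x ∷ w)                         ≡⟨ *ₛ-∷ f oneₛ x w ⟩
    f [] * 0# + (shiftₛ x f *ₛ oneₛ) w          ≈⟨ +-cong (zeroʳ _) (*ₛ-identityʳ (shiftₛ x f) w) ⟩
    0# + f (x ∷ w)                              ≈⟨ +-identityˡ _ ⟩
    f (x ∷ w)                                   ∎
    where open SetoidReasoning setoid

  *ₛ-assoc : ∀ f g h → ((f *ₛ g) *ₛ h) ≈ₛ (f *ₛ (g *ₛ h))
  *ₛ-assoc f g h [] = begin
    (f [] * g [] + 0#) * h [] + 0#   ≈⟨ +-identityʳ _ ⟩
    (f [] * g [] + 0#) * h []        ≈⟨ *-cong (+-identityʳ _) refl ⟩
    (f [] * g []) * h []             ≈⟨ *-assoc _ _ _ ⟩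
    f [] * (g [] * h [])             ≈⟨ *-cong refl (+-identityʳ _) ⟨
    f [] * (g [] * h [] + 0#)        ≈⟨ +-identityʳ _ ⟨
    f [] * (g [] * h [] + 0#) + 0#   ∎
    where open SetoidReasoning setoid
  *ₛ-assoc f g h (x ∷ w) = begin
    ((f *ₛ g) *ₛ h) (x ∷ w)
      ≡⟨ *ₛ-∷ (f *ₛ g) h x w ⟩
    (f *ₛ g) [] * h (x ∷ w) + (shiftₛ x (f *ₛ g) *ₛ h) w
      ≈⟨ +-cong refl (*ₛ-cong (λ u → reflexive (*ₛ-∷ f g x u)) (λ _ → refl) w) ⟩
    (f *ₛ g) [] * h (x ∷ w) + sumR (map (λ uv → (f [] * g′ (proj₁ uv) + f′g (proj₁ uv)) * h (proj₂ uv)) (splits w))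
      ≈⟨ +-cong refl leibniz ⟩
    (f [] * g [] + 0#) * h (x ∷ w) + (f [] * (g′ *ₛ h) w + (f′g *ₛ h) w)
      ≈⟨ +-cong refl (+-cong refl (*ₛ-assoc (shiftₛ x f) g h w)) ⟩
    (f [] * g [] + 0#) * h (x ∷ w) + (f [] * (g′ *ₛ h) w + (shiftₛ x f *ₛ (g *ₛ h)) w)
      ≈⟨ regroup _ _ _ _ _ ⟩
    f [] * (g [] * h (x ∷ w) + (g′ *ₛ h) w) + (shiftₛ x f *ₛ (g *ₛ h)) w
      ≡⟨ ≡.cong (λ t → f [] * t + (shiftₛ x f *ₛ (g *ₛ h)) w) (*ₛ-∷ g h x w) ⟨
    f [] * (g *ₛ h) (x ∷ w) + (shiftₛ x f *ₛ (g *ₛ h)) w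
      ≡⟨ *ₛ-∷ f (g *ₛ h) x w ⟨
    (f *ₛ (g *ₛ h)) (x ∷ w) ∎
    where
    open SetoidReasoning setoid
    g′ = shiftₛ x g
    f′g = shiftₛ x f *ₛ g

    leibniz : sumR (map (λ uv → (f [] * g′ (proj₁ uv) + f′g (proj₁ uv)) * h (proj₂ uv)) (splits w))
              ≈ f [] * (g′ *ₛ h) w + (f′g *ₛ h) w
    leibniz = begin
      _ ≈⟨ sumR-cong (splits w) (λ _ → distribʳ _ _ _) ⟩
      _ ≈⟨ sumR-+ (splits w) _ _ ⟩
      _ ≈⟨ +-cong (sumR-cong (splits w) (λ _ → *-assoc _ _ _)) refl ⟩
      _ ≈⟨ +-cong (sumR-*ˡ (splits w) (f []) _) refl ⟩
      _ ∎

    regroup : ∀ a b c d e → (a * b + 0#) * c + (a * d + e) ≈ a * (b * c + d) + e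
    regroup a b c d e = begin
      (a * b + 0#) * c + (a * d + e) ≈⟨ +-cong (*-cong (+-identityʳ _) refl) refl ⟩
      (a * b) * c + (a * d + e)      ≈⟨ +-cong (*-assoc a b c) refl ⟩
      a * (b * c) + (a * d + e)      ≈⟨ +-assoc _ _ _ ⟨
      (a * (b * c) + a * d) + e      ≈⟨ +-cong (distribˡ a _ _) refl ⟨
      a * (b * c + d) + e            ∎

  *ₛ-isMonoid : IsMonoid _≈ₛ_ _*ₛ_ oneₛ
  *ₛ-isMonoid = record
    { isSemigroup = record
      { isMagma = record { isEquivalence = Setoid.isEquivalence ≈ₛ-setoid ; ∙-cong = *ₛ-cong }
      ; assoc = *ₛ-assoc
      }
    ; identity = *ₛ-identityˡ , *ₛ-identityʳ
    }

  *ₛ-monoid : Monoid (a ⊔ c) (a ⊔ ℓ)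
  *ₛ-monoid = record { isMonoid = *ₛ-isMonoid }

  open MonoidProperties *ₛ-monoid public using (cancelˡ; cancelᶜ)
  open SemigroupProperties (Monoid.semigroup *ₛ-monoid) public using ([u∙vw]x≈uv∙wx)

  ConstTermOne : Ser → Set ℓ
  ConstTermOne f = f [] ≈ 1#

  *ₛ-constTermOne : ∀ {f g} → ConstTermOne f → ConstTermOne g → ConstTermOne (f *ₛ g)
  *ₛ-constTermOne e e′ = trans (+-identityʳ _) (trans (*-cong e e′) (*-identityˡ 1#))

  invₛ-constTermOne : ∀ f → ConstTermOne (invₛ f)
  invₛ-constTermOne f = refl

  splits-suffix-≤ : ∀ w → All (λ uv → length (proj₂ uv) ≤ℕ length w) (splits w)
  splits-suffix-≤ []      = z≤n ∷ []
  splits-suffix-≤ (x ∷ w) = ≤-refl ∷ map⁺ (All.map m≤n⇒m≤1+n (splits-suffix-≤ w))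

  invAux-cong : ∀ {f g} n m v → f ≈ₛ g → length v ≤ℕ n → length v ≤ℕ m →
                invAux n f v ≈ invAux m g v
  invAux-cong n       m       []      e _       _       = refl
  invAux-cong (suc n) (suc m) (x ∷ w) e (s≤s l) (s≤s l′) =
    -‿cong (sumR-cong-All (splits-suffix-≤ w) λ uv uv≤w →
      *-cong (e _) (invAux-cong n m (proj₂ uv) e (≤-trans uv≤w l) (≤-trans uv≤w l′)))

  invₛ-cong : ∀ {f g} → f ≈ₛ g → invₛ f ≈ₛ invₛ g
  invₛ-cong e w = invAux-cong (length w) (length w) w e ≤-refl ≤-refl

  *ₛ-inverseʳ : ∀ f → ConstTermOne f → (f *ₛ invₛ f) ≈ₛ oneₛ
  *ₛ-inverseʳ f e []      = trans (+-identityʳ _) (trans (*-identityʳ _) e)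
  *ₛ-inverseʳ f e (x ∷ w) = begin
    (f *ₛ invₛ f) (x ∷ w)      ≡⟨ *ₛ-∷ f (invₛ f) x w ⟩
    f [] * invₛ f (x ∷ w) + S  ≈⟨ +-cong (*-cong e (-‿cong (sumR-cong-All (splits-suffix-≤ w) λ uv uv≤w →
                                    *-cong refl (invAux-cong _ _ (proj₂ uv) ≈ₛ-refl uv≤w ≤-refl)))) refl ⟩
    1# * (- S) + S             ≈⟨ +-cong (*-identityˡ _) refl ⟩
    - S + S                    ≈⟨ -‿inverseˡ S ⟩
    0#                         ∎
    where
    open SetoidReasoning setoid
    S = (shiftₛ x f *ₛ invₛ f) w

  -- invₛ f has constant term 1, so it has a right inverse, which must then be f.
  *ₛ-inverseˡ : ∀ f → ConstTermOne f → (invₛ f *ₛ f) ≈ₛ oneₛ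
  *ₛ-inverseˡ f e = ≈ₛ-trans (*ₛ-cong ≈ₛ-refl f≈h) (*ₛ-inverseʳ g refl)
    where
    open SetoidReasoning ≈ₛ-setoid
    g = invₛ f
    h = invₛ g
    f≈h : f ≈ₛ h
    f≈h = begin
      f                ≈⟨ *ₛ-identityʳ f ⟨
      f *ₛ oneₛ        ≈⟨ *ₛ-cong ≈ₛ-refl (*ₛ-inverseʳ g refl) ⟨
      f *ₛ (g *ₛ h)    ≈⟨ *ₛ-assoc f g h ⟨
      (f *ₛ g) *ₛ h    ≈⟨ *ₛ-cong (*ₛ-inverseʳ f e) ≈ₛ-refl ⟩
      oneₛ *ₛ h        ≈⟨ *ₛ-identityˡ h ⟩
      h                ∎

  invₛ-unique : ∀ f g → ConstTermOne f → (f *ₛ g) ≈ₛ oneₛ → g ≈ₛ invₛ f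
  invₛ-unique f g e fg≈1 = begin
    g                     ≈⟨ cancelˡ (*ₛ-inverseˡ f e) g ⟨
    invₛ f *ₛ (f *ₛ g)    ≈⟨ *ₛ-cong ≈ₛ-refl fg≈1 ⟩
    invₛ f *ₛ oneₛ        ≈⟨ *ₛ-identityʳ _ ⟩
    invₛ f                ∎
    where open SetoidReasoning ≈ₛ-setoid

  invₛ-anti-*ₛ : ∀ f g → ConstTermOne f → ConstTermOne g → invₛ (f *ₛ g) ≈ₛ (invₛ g *ₛ invₛ f)
  invₛ-anti-*ₛ f g ef eg = ≈ₛ-sym (invₛ-unique (f *ₛ g) _ (*ₛ-constTermOne {f} {g} ef eg) (begin
    (f *ₛ g) *ₛ (invₛ g *ₛ invₛ f)   ≈⟨ cancelᶜ (*ₛ-inverseʳ g eg) f (invₛ f) ⟩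
    f *ₛ invₛ f                      ≈⟨ *ₛ-inverseʳ f ef ⟩
    oneₛ                             ∎))
    where open SetoidReasoning ≈ₛ-setoid

  invₛ-oneₛ : invₛ oneₛ ≈ₛ oneₛ
  invₛ-oneₛ = ≈ₛ-sym (invₛ-unique oneₛ oneₛ refl (*ₛ-identityˡ oneₛ))

InU-negˡ : ∀ p q → InU p q → InU (-ℤ p) q
InU-negˡ p q c rewrite ∣-i∣≡∣i∣ p = c

InU-negʳ : ∀ p q → InU p q → InU p (-ℤ q)
InU-negʳ p q c rewrite ∣-i∣≡∣i∣ q = c

InU-sym : ∀ p q → InU p q → InU q p
InU-sym p q = Coprimality.sym

InU-rotate : ∀ p q → InU p q → InU (-ℤ q) p
InU-rotate p q c = InU-negˡ q p (InU-sym p q c)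

InU-+ʳ : ∀ p q → InU p q → InU p (p +ℤ q)
InU-+ʳ p q c {d} (d∣p , d∣p+q) =
  c (d∣p , ∣⇒∣ᵤ (∣m+n∣m⇒∣n (∣ᵤ⇒∣ {+ d} {p +ℤ q} d∣p+q) (∣ᵤ⇒∣ {+ d} {p} d∣p)))

InU-+ˡ : ∀ p q → InU p q → InU (p +ℤ q) q
InU-+ˡ p q c rewrite +-comm p q = InU-sym q (q +ℤ p) (InU-+ʳ q p (InU-sym p q c))

[p+q]-p≡q : ∀ p q → (p +ℤ q) +ℤ (-ℤ p) ≡ q
[p+q]-p≡q = ℤ-Solver.solve-∀

-q+[p+q]≡p : ∀ p q → (-ℤ q) +ℤ (p +ℤ q) ≡ p
-q+[p+q]≡p = ℤ-Solver.solve-∀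

module FunctionsOnU {c ℓ} (R : CommutativeRing c ℓ) {a} (A : Set a) where
  open CommutativeRing R
  open Series R A
  open SeriesAlgebra R A

  ≈U-setoid : Setoid (a ⊔ c) (a ⊔ ℓ)
  ≈U-setoid = record
    { Carrier = Fun
    ; _≈_ = _≈U_
    ; isEquivalence = record
      { refl = λ _ _ _ → ≈ₛ-refl
      ; sym = λ e p q u → ≈ₛ-sym (e p q u)
      ; trans = λ e e′ p q u → ≈ₛ-trans (e p q u) (e′ p q u)
      }
    }

  open Setoid ≈U-setoid public using ()
    renaming (refl to ≈U-refl; sym to ≈U-sym; trans to ≈U-trans)

  pointwise : ∀ {F G} → (∀ p q → F p q ≈ₛ G p q) → F ≈U G
  pointwise e p q _ = e p q

  infixl 7 _*F_

  _*F_ : Fun → Fun → Fun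
  (D *F E) p q = D p q *ₛ E p q

  invF : Fun → Fun
  invF D p q = invₛ (D p q)

  *F-cong : ∀ {D D′ E E′} → D ≈U D′ → E ≈U E′ → (D *F E) ≈U (D′ *F E′)
  *F-cong e e′ p q u = *ₛ-cong (e p q u) (e′ p q u)

  assoc-cong : ∀ {D D′} → D ≈U D′ → assoc D ≈U assoc D′
  assoc-cong e p q u = *ₛ-cong (e p q u) (invₛ-cong (e (-ℤ q) p (InU-rotate p q u)))

  assoc-oneF : assoc oneF ≈U oneF
  assoc-oneF = pointwise λ _ _ → ≈ₛ-trans (*ₛ-cong ≈ₛ-refl invₛ-oneₛ) (*ₛ-identityˡ oneₛ)

  IsMRF-resp-≈U : ∀ {F G} → F ≈U G → IsMRF F → IsMRF G
  IsMRF-resp-≈U {F} {G} e (one , sign , reciprocity , period) =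
    (λ p q u → trans (sym (e p q u [])) (one p q u)) ,
    (λ p q u → ≈ₛ-trans (≈ₛ-sym (e p (-ℤ q) (InU-negʳ p q u)))
                 (≈ₛ-trans (sign p q u) (e (-ℤ p) q (InU-negˡ p q u)))) ,
    (λ p q u → ≈ₛ-trans (*ₛ-cong (≈ₛ-sym (e p q u)) (≈ₛ-sym (e (-ℤ q) p (InU-rotate p q u))))
                 (reciprocity p q u)) ,
    (λ p q u → ≈ₛ-trans (*ₛ-cong (≈ₛ-sym (e p (p +ℤ q) (InU-+ʳ p q u)))
                                 (≈ₛ-sym (e (p +ℤ q) q (InU-+ˡ p q u))))
                 (≈ₛ-trans (period p q u) (e p q u)))

  module AssociatedFunction {D : Fun} (isMDS : IsMDS D) where
    private
      one : ConstOne D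
      one = proj₁ isMDS
      sign : ∀ p q → InU p q → D p (-ℤ q) ≈ₛ D (-ℤ p) q
      sign = proj₁ (proj₂ isMDS)
      period : ∀ p q → InU p q → D p q ≈ₛ D p (p +ℤ q)
      period = proj₂ (proj₂ isMDS)

    D-swap : ∀ p q → InU p q → D q p ≈ₛ D (-ℤ q) (-ℤ p)
    D-swap p q u = ≈ₛ-trans (≈ₛ-reflexive (≡.cong (D q) (≡.sym (neg-involutive p))))
                            (sign q (-ℤ p) (InU-negʳ q p (InU-sym p q u)))

    assoc-constTermOne : ConstOne (assoc D)
    assoc-constTermOne p q u = *ₛ-constTermOne {D p q} {invₛ (D (-ℤ q) p)} (one p q u) (invₛ-constTermOne (D (-ℤ q) p))

    assoc-sign : ∀ p q → InU p q → assoc D p (-ℤ q) ≈ₛ assoc D (-ℤ p) q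
    assoc-sign p q u = *ₛ-cong (sign p q u)
      (invₛ-cong (≈ₛ-trans (≈ₛ-reflexive (≡.cong (λ t → D t p) (neg-involutive q))) (D-swap p q u)))

    assoc-reciprocity : ∀ p q → InU p q → (assoc D p q *ₛ assoc D (-ℤ q) p) ≈ₛ oneₛ
    assoc-reciprocity p q u = begin
      (D p q *ₛ invₛ (D (-ℤ q) p)) *ₛ (D (-ℤ q) p *ₛ invₛ (D (-ℤ p) (-ℤ q)))
        ≈⟨ cancelᶜ (*ₛ-inverseˡ _ (one (-ℤ q) p (InU-rotate p q u))) _ _ ⟩
      D p q *ₛ invₛ (D (-ℤ p) (-ℤ q))
        ≈⟨ *ₛ-cong ≈ₛ-refl (invₛ-cong (D-swap q p (InU-sym p q u))) ⟨
      D p q *ₛ invₛ (D p q)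
        ≈⟨ *ₛ-inverseʳ _ (one p q u) ⟩
      oneₛ ∎
      where open SetoidReasoning ≈ₛ-setoid

    assoc-period : ∀ p q → InU p q → (assoc D p (p +ℤ q) *ₛ assoc D (p +ℤ q) q) ≈ₛ assoc D p q
    assoc-period p q u = begin
      (D p (p +ℤ q) *ₛ invₛ (D (-ℤ (p +ℤ q)) p)) *ₛ (D (p +ℤ q) q *ₛ invₛ (D (-ℤ q) (p +ℤ q)))
        ≈⟨ *ₛ-cong (*ₛ-cong ≈ₛ-refl (invₛ-cong D-[p+q]-p≈D-[p+q]-q)) ≈ₛ-refl ⟩
      (D p (p +ℤ q) *ₛ invₛ (D (p +ℤ q) q)) *ₛ (D (p +ℤ q) q *ₛ invₛ (D (-ℤ q) (p +ℤ q)))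
        ≈⟨ cancelᶜ (*ₛ-inverseˡ _ (one _ _ (InU-+ˡ p q u))) _ _ ⟩
      D p (p +ℤ q) *ₛ invₛ (D (-ℤ q) (p +ℤ q))
        ≈⟨ *ₛ-cong (≈ₛ-sym (period p q u)) (invₛ-cong D-q-[p+q]≈D-q-p) ⟩
      D p q *ₛ invₛ (D (-ℤ q) p) ∎
      where
      open SetoidReasoning ≈ₛ-setoid
      u′ : InU (p +ℤ q) p
      u′ = InU-sym p (p +ℤ q) (InU-+ʳ p q u)
      D-[p+q]-p≈D-[p+q]-q : D (-ℤ (p +ℤ q)) p ≈ₛ D (p +ℤ q) q
      D-[p+q]-p≈D-[p+q]-q = begin
        D (-ℤ (p +ℤ q)) p                 ≈⟨ sign (p +ℤ q) p u′ ⟨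
        D (p +ℤ q) (-ℤ p)                 ≈⟨ period (p +ℤ q) (-ℤ p) (InU-negʳ (p +ℤ q) p u′) ⟩
        D (p +ℤ q) ((p +ℤ q) +ℤ (-ℤ p))   ≡⟨ ≡.cong (D (p +ℤ q)) ([p+q]-p≡q p q) ⟩
        D (p +ℤ q) q                      ∎
      D-q-[p+q]≈D-q-p : D (-ℤ q) (p +ℤ q) ≈ₛ D (-ℤ q) p
      D-q-[p+q]≈D-q-p = begin
        D (-ℤ q) (p +ℤ q)                 ≈⟨ period (-ℤ q) (p +ℤ q) (InU-negˡ q (p +ℤ q) (InU-sym (p +ℤ q) q (InU-+ˡ p q u))) ⟩
        D (-ℤ q) ((-ℤ q) +ℤ (p +ℤ q))     ≡⟨ ≡.cong (D (-ℤ q)) (-q+[p+q]≡p p q) ⟩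
        D (-ℤ q) p                        ∎

    assoc-isMRF : IsMRF (assoc D)
    assoc-isMRF = assoc-constTermOne , assoc-sign , assoc-reciprocity , assoc-period

  open AssociatedFunction public using (assoc-isMRF)

  IsNormMDS-*F : ∀ {D E} → IsNormMDS D → IsNormMDS E → IsNormMDS (D *F E)
  IsNormMDS-*F {D} {E} ((one , sign , period) , norm) ((one′ , sign′ , period′) , norm′) =
    ((λ p q u → *ₛ-constTermOne {D p q} {E p q} (one p q u) (one′ p q u)) ,
     (λ p q u → *ₛ-cong (sign p q u) (sign′ p q u)) ,
     (λ p q u → *ₛ-cong (period p q u) (period′ p q u))) ,
    ≈ₛ-trans (*ₛ-cong norm norm′) (*ₛ-identityˡ oneₛ)

  IsNormMDS-invF : ∀ {D} → IsNormMDS D → IsNormMDS (invF D)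
  IsNormMDS-invF {D} ((_ , sign , period) , norm) =
    ((λ p q u → invₛ-constTermOne (D p q)) ,
     (λ p q u → invₛ-cong (sign p q u)) ,
     (λ p q u → invₛ-cong (period p q u))) ,
    ≈ₛ-trans (invₛ-cong norm) invₛ-oneₛ

  IsNormMDS-oneF : IsNormMDS oneF
  IsNormMDS-oneF = ((λ _ _ _ → refl) , (λ _ _ _ → ≈ₛ-refl) , (λ _ _ _ → ≈ₛ-refl)) , ≈ₛ-refl

  IsMRF-oneF : IsMRF oneF
  IsMRF-oneF = IsMRF-resp-≈U assoc-oneF (assoc-isMRF (proj₁ IsNormMDS-oneF))

module BulletProduct {c ℓ} (R : CommutativeRing c ℓ) {a} (A : Set a)
                     (d : Series.Fun R A → Series.Fun R A)
                     (spec : Series.DFSpec R A d) (unique : Series.DFUnique R A) where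
  open Series R A
  open SeriesAlgebra R A
  open FunctionsOnU R A

  d-isNormMDS : ∀ {F} → IsMRF F → IsNormMDS (d F)
  d-isNormMDS mF = proj₁ (spec _ mF)

  assoc-d : ∀ {F} → IsMRF F → assoc (d F) ≈U F
  assoc-d mF = proj₂ (spec _ mF)

  d-unique : ∀ {F D} → IsMRF F → IsNormMDS D → assoc D ≈U F → d F ≈U D
  d-unique mF nD e = unique _ _ _ mF (d-isNormMDS mF) nD (assoc-d mF) e

  bullet≈assoc-*F : ∀ {F G} → IsMRF F → IsMRF G → bullet d F G ≈U assoc (d F *F d G)
  bullet≈assoc-*F {F} {G} mF mG p q u = begin
    α *ₛ G p q *ₛ invₛ α′                        ≈⟨ *ₛ-cong (*ₛ-cong ≈ₛ-refl (≈ₛ-sym (assoc-d mG p q u))) ≈ₛ-refl ⟩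
    α *ₛ (β *ₛ invₛ β′) *ₛ invₛ α′               ≈⟨ [u∙vw]x≈uv∙wx α β (invₛ β′) (invₛ α′) ⟩
    (α *ₛ β) *ₛ (invₛ β′ *ₛ invₛ α′)             ≈⟨ *ₛ-cong ≈ₛ-refl (invₛ-anti-*ₛ α′ β′ (one F mF) (one G mG)) ⟨
    (α *ₛ β) *ₛ invₛ (α′ *ₛ β′)                  ∎
    where
    open SetoidReasoning ≈ₛ-setoid
    α = d F p q
    β = d G p q
    α′ = d F (-ℤ q) p
    β′ = d G (-ℤ q) p
    one : ∀ H → IsMRF H → ConstTermOne (d H (-ℤ q) p)
    one H mH = proj₁ (proj₁ (d-isNormMDS mH)) (-ℤ q) p (InU-rotate p q u)

  bullet-isMRF : ∀ {F G} → IsMRF F → IsMRF G → IsMRF (bullet d F G)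
  bullet-isMRF mF mG = IsMRF-resp-≈U (≈U-sym (bullet≈assoc-*F mF mG))
    (assoc-isMRF (proj₁ (IsNormMDS-*F (d-isNormMDS mF) (d-isNormMDS mG))))

  d-bullet : ∀ {F G} → IsMRF F → IsMRF G → d (bullet d F G) ≈U (d F *F d G)
  d-bullet mF mG = d-unique (bullet-isMRF mF mG)
    (IsNormMDS-*F (d-isNormMDS mF) (d-isNormMDS mG)) (≈U-sym (bullet≈assoc-*F mF mG))

  d-oneF : d oneF ≈U oneF
  d-oneF = d-unique IsMRF-oneF IsNormMDS-oneF assoc-oneF

  bullet-assoc : ∀ {F G H} → IsMRF F → IsMRF G → IsMRF H →
                 bullet d (bullet d F G) H ≈U bullet d F (bullet d G H)
  bullet-assoc {F} {G} {H} mF mG mH = begin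
    bullet d (bullet d F G) H          ≈⟨ bullet≈assoc-*F (bullet-isMRF mF mG) mH ⟩
    assoc (d (bullet d F G) *F d H)    ≈⟨ assoc-cong (*F-cong (d-bullet mF mG) ≈U-refl) ⟩
    assoc ((d F *F d G) *F d H)        ≈⟨ assoc-cong (pointwise λ p q → *ₛ-assoc _ _ _) ⟩
    assoc (d F *F (d G *F d H))        ≈⟨ assoc-cong (*F-cong ≈U-refl (d-bullet mG mH)) ⟨
    assoc (d F *F d (bullet d G H))    ≈⟨ bullet≈assoc-*F mF (bullet-isMRF mG mH) ⟨
    bullet d F (bullet d G H)          ∎
    where open SetoidReasoning ≈U-setoid

  bullet-identityˡ : ∀ {F} → IsMRF F → bullet d oneF F ≈U F
  bullet-identityˡ {F} mF = begin
    bullet d oneF F           ≈⟨ bullet≈assoc-*F IsMRF-oneF mF ⟩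
    assoc (d oneF *F d F)     ≈⟨ assoc-cong (*F-cong d-oneF ≈U-refl) ⟩
    assoc (oneF *F d F)       ≈⟨ assoc-cong (pointwise λ p q → *ₛ-identityˡ _) ⟩
    assoc (d F)               ≈⟨ assoc-d mF ⟩
    F                         ∎
    where open SetoidReasoning ≈U-setoid

  bullet-identityʳ : ∀ {F} → IsMRF F → bullet d F oneF ≈U F
  bullet-identityʳ mF = ≈U-trans (pointwise λ p q → *ₛ-cong (*ₛ-identityʳ _) ≈ₛ-refl) (assoc-d mF)

  module Inverse {F : Fun} (mF : IsMRF F) where
    open SetoidReasoning ≈U-setoid

    F⁻¹ : Fun
    F⁻¹ = assoc (invF (d F))

    F⁻¹-isMRF : IsMRF F⁻¹
    F⁻¹-isMRF = assoc-isMRF (proj₁ (IsNormMDS-invF (d-isNormMDS mF)))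

    d-F⁻¹ : d F⁻¹ ≈U invF (d F)
    d-F⁻¹ = d-unique F⁻¹-isMRF (IsNormMDS-invF (d-isNormMDS mF)) ≈U-refl

    d-constTermOne : ∀ p q → InU p q → ConstTermOne (d F p q)
    d-constTermOne = proj₁ (proj₁ (d-isNormMDS mF))

    bullet-inverseʳ : bullet d F F⁻¹ ≈U oneF
    bullet-inverseʳ = begin
      bullet d F F⁻¹             ≈⟨ bullet≈assoc-*F mF F⁻¹-isMRF ⟩
      assoc (d F *F d F⁻¹)       ≈⟨ assoc-cong (*F-cong ≈U-refl d-F⁻¹) ⟩
      assoc (d F *F invF (d F))  ≈⟨ assoc-cong (λ p q u → *ₛ-inverseʳ _ (d-constTermOne p q u)) ⟩
      assoc oneF                 ≈⟨ assoc-oneF ⟩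
      oneF                       ∎

    bullet-inverseˡ : bullet d F⁻¹ F ≈U oneF
    bullet-inverseˡ = begin
      bullet d F⁻¹ F             ≈⟨ bullet≈assoc-*F F⁻¹-isMRF mF ⟩
      assoc (d F⁻¹ *F d F)       ≈⟨ assoc-cong (*F-cong d-F⁻¹ ≈U-refl) ⟩
      assoc (invF (d F) *F d F)  ≈⟨ assoc-cong (λ p q u → *ₛ-inverseˡ _ (d-constTermOne p q u)) ⟩
      assoc oneF                 ≈⟨ assoc-oneF ⟩
      oneF                       ∎

    -- A right inverse G forces D_F · D_G = 1, by uniqueness of the symbol of oneF.
    bullet-inverseʳ-unique : ∀ {G} → IsMRF G → bullet d F G ≈U oneF → G ≈U F⁻¹
    bullet-inverseʳ-unique {G} mG FG≈1 = begin
      G                     ≈⟨ assoc-d mG ⟨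
      assoc (d G)           ≈⟨ assoc-cong d-G≈invF-d-F ⟩
      assoc (invF (d F))    ∎
      where
      d-F*d-G≈1 : (d F *F d G) ≈U oneF
      d-F*d-G≈1 = unique oneF _ _ IsMRF-oneF (IsNormMDS-*F (d-isNormMDS mF) (d-isNormMDS mG))
        IsNormMDS-oneF (≈U-trans (≈U-sym (bullet≈assoc-*F mF mG)) FG≈1) assoc-oneF
      d-G≈invF-d-F : d G ≈U invF (d F)
      d-G≈invF-d-F p q u = invₛ-unique _ _ (d-constTermOne p q u) (d-F*d-G≈1 p q u)

proposition4p2 : ∀ {c ℓ a} (R : CommutativeRing c ℓ) (A : Set a) →
    let open Series R A in
    (d : Fun → Fun) → DFSpec d → DFUnique →
    -- • is an operation on the set of multiple reciprocity functions
    (∀ F G → IsMRF F → IsMRF G → IsMRF (bullet d F G))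
    -- associativity
    × (∀ F G H → IsMRF F → IsMRF G → IsMRF H →
         bullet d (bullet d F G) H ≈U bullet d F (bullet d G H))
    -- the constant function 1 is a (two-sided) unit
    × IsMRF oneF
    × (∀ F → IsMRF F → (bullet d oneF F ≈U F) × (bullet d F oneF ≈U F))
    -- existence of an inverse
    × (∀ F → IsMRF F → Σ Fun (λ G → IsMRF G
         × (bullet d F G ≈U oneF) × (bullet d G F ≈U oneF)))
    -- uniqueness of the inverse
    × (∀ F G G′ → IsMRF F → IsMRF G → IsMRF G′
         → (bullet d F G ≈U oneF) → (bullet d G F ≈U oneF)
         → (bullet d F G′ ≈U oneF) → (bullet d G′ F ≈U oneF)
         → G ≈U G′)
proposition4p2 R A d spec unique =
  (λ _ _ → bullet-isMRF) ,
  (λ _ _ _ → bullet-assoc) ,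
  IsMRF-oneF ,
  (λ _ mF → bullet-identityˡ mF , bullet-identityʳ mF) ,
  (λ _ mF → let open Inverse mF in F⁻¹ , F⁻¹-isMRF , bullet-inverseʳ , bullet-inverseˡ) ,
  (λ _ _ _ mF mG mG′ FG≈1 _ FG′≈1 _ → let open Inverse mF in
     ≈U-trans (bullet-inverseʳ-unique mG FG≈1) (≈U-sym (bullet-inverseʳ-unique mG′ FG′≈1)))
  where
  open FunctionsOnU R A using (≈U-trans; ≈U-sym; IsMRF-oneF)
  open BulletProduct R A d spec unique
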